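{- There exist a homogeneous parity signed graph $S$ and a connected subsigned graph $S'$ of $S$ (a subgraph $H$ of the underlying graph of $S$, with each edge keeping its sign from $S$) such that $S'$ is not a parity signed graph. That is, a connected subsigned graph of a homogeneous parity signed graph need not be a parity signed graph.
   Context: A signed graph is a pair $S=(G,\sigma)$ where $G=(V,E)$ is a simple graph and $\sigma:E(G)\to\{+,-\}$. It is homogeneous if all its edges have the same sign. A signed graph $S=(G,\sigma)$ with $n=|V(G)|$ is a parity signed graph if there exists a bijection $f:V(G)\to\{1,2,\dots,n\}$ such that for every edge $uv$, $\sigma(uv)=+$ if $f(u)$ and $f(v)$ have the same parity, and $\sigma(uv)=-$ if they have opposite parity. -}

module Defs where

open import Data.Nat using (ℕ; zero; suc; _≥_)
open import Data.Nat.Base using (_%_)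
open import Data.Fin using (Fin; toℕ)
open import Data.Bool using (Bool; true; false)
open import Data.Product using (Σ; _×_; ∃; _,_)
open import Data.Sum using (_⊎_)
open import Data.List using (List; []; _∷_)
open import Relation.Binary.PropositionalEquality using (_≡_)
open import Function.Bundles using (_⤖_; _↣_; Injection; Bijection)

-- Signs: true = +, false = -
Sign : Set
Sign = Bool

record SignedGraph : Set where
  field
    n      : ℕ
    adj    : Fin n → Fin n → Bool
    adj-sym   : ∀ u v → adj u v ≡ adj v u
    adj-irr   : ∀ u → adj u u ≡ false
    sign   : Fin n → Fin n → Sign
    sign-sym  : ∀ u v → adj u v ≡ true → sign u v ≡ sign v u
open SignedGraph public

Edge : (S : SignedGraph) → Fin (n S) → Fin (n S) → Set
Edge S u v = adj S u v ≡ true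

Homogeneous : SignedGraph → Set
Homogeneous S = Σ Sign λ s → ∀ u v → Edge S u v → sign S u v ≡ s

-- label of vertex under a bijection Fin n ⤖ Fin n: value toℕ (f u) + 1 ∈ {1..n}
-- sign determined by parity: + iff same parity.
signOfParity : ℕ → ℕ → Sign
signOfParity a b with a % 2 | b % 2
... | zero  | zero  = true
... | suc _ | suc _ = true
... | _     | _     = false

IsParitySignedGraph : SignedGraph → Set
IsParitySignedGraph S =
  Σ (Fin (n S) ⤖ Fin (n S)) λ f →
    ∀ u v → Edge S u v →
      sign S u v ≡ signOfParity (suc (toℕ (Bijection.to f u))) (suc (toℕ (Bijection.to f v)))

data Walk (S : SignedGraph) : Fin (n S) → Fin (n S) → Set where
  here : ∀ {u} → Walk S u u
  step : ∀ {u w v} → Edge S u w → Walk S w v → Walk S u v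

Connected : SignedGraph → Set
Connected S = (n S ≥ 1) × (∀ u v → Walk S u v)

IsSubsignedGraph : SignedGraph → SignedGraph → Set
IsSubsignedGraph S' S =
  Σ (Fin (n S') ↣ Fin (n S)) λ ι →
    ∀ u v → Edge S' u v →
      (Edge S (Injection.to ι u) (Injection.to ι v)) ×
      (sign S' u v ≡ sign S (Injection.to ι u) (Injection.to ι v))

-- Every label set {1, …, n} with n ≥ 2 contains both 1 and 2, so a parity
-- labelling of the all-positive complete graph Kₙ must put opposite parities
-- on the endpoints of some positive edge; hence K₂⁺ is not a parity signed
-- graph.  On the other hand, joining exactly the vertices whose labels have the
-- same parity gives an all-positive parity signed graph, and for n = 3 it has
-- the positive edge between the labels 1 and 3, which is a copy of K₂⁺.
module Submission where

open import Defs
open import Data.Bool using (Bool; true; false; not; _∧_)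
open import Data.Bool.Properties using (∧-conicalʳ)
open import Data.Empty using (⊥-elim)
open import Data.Fin using (Fin; zero; suc; toℕ; _≟_)
open import Data.Nat using (ℕ; zero; suc; s≤s; z≤n; _%_)
open import Data.Product using (Σ; _×_; _,_; proj₁; proj₂)
open import Function.Bundles using (Bijection; mk⇔; mk↣)
open import Function.Construct.Identity using (⤖-id)
open import Relation.Binary.PropositionalEquality
  using (_≡_; _≢_; refl; sym; trans; cong; cong₂)
open import Relation.Nullary using (¬_; does; yes; no)
open import Relation.Nullary.Decidable using (dec-true; dec-false; does-⇔)

true≢false : true ≢ false
true≢false ()

distinct : ∀ {n} → Fin n → Fin n → Bool
distinct u v = not (does (u ≟ v))

distinct-sym : ∀ {n} (u v : Fin n) → distinct u v ≡ distinct v u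
distinct-sym u v = cong not (does-⇔ (mk⇔ sym sym) (u ≟ v) (v ≟ u))

distinct-irr : ∀ {n} (u : Fin n) → distinct u u ≡ false
distinct-irr u = cong not (dec-true (u ≟ u) refl)

distinct-≢ : ∀ {n} {u v : Fin n} → u ≢ v → distinct u v ≡ true
distinct-≢ {u = u} {v} u≢v = cong not (dec-false (u ≟ v) u≢v)

label : ∀ {n} → Fin n → ℕ
label u = suc (toℕ u)

positiveGraph : (n : ℕ) (adj : Fin n → Fin n → Bool) →
                (∀ u v → adj u v ≡ adj v u) → (∀ u → adj u u ≡ false) → SignedGraph
positiveGraph n adj adj-sym adj-irr = record
  { n = n ; adj = adj ; adj-sym = adj-sym ; adj-irr = adj-irr
  ; sign = λ _ _ → true ; sign-sym = λ _ _ _ → refl }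

positiveComplete : ℕ → SignedGraph
positiveComplete n = positiveGraph n distinct distinct-sym distinct-irr

positiveComplete-connected : ∀ n → Connected (positiveComplete (suc n))
positiveComplete-connected n = s≤s z≤n , walk
  where
  walk : ∀ u v → Walk (positiveComplete (suc n)) u v
  walk u v with u ≟ v
  ... | yes refl = here
  ... | no u≢v   = step (distinct-≢ u≢v) here

positiveComplete-notParity : ∀ n → ¬ IsParitySignedGraph (positiveComplete (suc (suc n)))
positiveComplete-notParity n (f , parity) =
  true≢false (trans (parity u₁ u₂ (distinct-≢ u₁≢u₂)) labelled-1-and-2)
  where
  open Bijection f using (to; strictlySurjective)
  u₁ u₂ : Fin (suc (suc n))
  u₁ = proj₁ (strictlySurjective zero)
  u₂ = proj₁ (strictlySurjective (suc zero))
  to-u₁ : to u₁ ≡ zero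
  to-u₁ = proj₂ (strictlySurjective zero)
  to-u₂ : to u₂ ≡ suc zero
  to-u₂ = proj₂ (strictlySurjective (suc zero))
  u₁≢u₂ : u₁ ≢ u₂
  u₁≢u₂ u₁≡u₂ with () ← trans (sym to-u₁) (trans (cong to u₁≡u₂) to-u₂)
  labelled-1-and-2 : signOfParity (label (to u₁)) (label (to u₂)) ≡ signOfParity 1 2
  labelled-1-and-2 = cong₂ (λ a b → signOfParity (label a) (label b)) to-u₁ to-u₂

positiveEdge⇒positiveComplete₂-subsigned : ∀ S {a b} → Edge S a b → sign S a b ≡ true →
                                          IsSubsignedGraph (positiveComplete 2) S
positiveEdge⇒positiveComplete₂-subsigned S {a} {b} ab positive = mk↣ ι-injective , preserves
  where
  ι : Fin 2 → Fin (n S)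
  ι zero       = a
  ι (suc zero) = b
  a≢b : a ≢ b
  a≢b refl = true≢false (trans (sym ab) (adj-irr S a))
  ι-injective : ∀ {x y} → ι x ≡ ι y → x ≡ y
  ι-injective {zero}     {zero}     _   = refl
  ι-injective {zero}     {suc zero} a≡b = ⊥-elim (a≢b a≡b)
  ι-injective {suc zero} {zero}     b≡a = ⊥-elim (a≢b (sym b≡a))
  ι-injective {suc zero} {suc zero} _   = refl
  ba : Edge S b a
  ba = trans (adj-sym S b a) ab
  preserves : ∀ u v → Edge (positiveComplete 2) u v →
              Edge S (ι u) (ι v) × (true ≡ sign S (ι u) (ι v))
  preserves zero       (suc zero) _ = ab , sym positive
  preserves (suc zero) zero       _ = ba , sym (trans (sign-sym S b a ba) positive)
  preserves (suc zero) (suc zero) ()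

signOfParity-sym : ∀ a b → signOfParity a b ≡ signOfParity b a
signOfParity-sym a b with a % 2 | b % 2
... | zero  | zero  = refl
... | zero  | suc _ = refl
... | suc _ | zero  = refl
... | suc _ | suc _ = refl

sameParityAdj : ∀ {n} → Fin n → Fin n → Bool
sameParityAdj u v = distinct u v ∧ signOfParity (label u) (label v)

sameParityGraph : ℕ → SignedGraph
sameParityGraph n = positiveGraph n sameParityAdj
  (λ u v → cong₂ _∧_ (distinct-sym u v) (signOfParity-sym (label u) (label v)))
  (λ u → cong (_∧ signOfParity (label u) (label u)) (distinct-irr u))

sameParityGraph-homogeneous : ∀ n → Homogeneous (sameParityGraph n)
sameParityGraph-homogeneous n = true , λ _ _ _ → refl

sameParityGraph-parity : ∀ n → IsParitySignedGraph (sameParityGraph n)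
sameParityGraph-parity n = ⤖-id _ , λ u v uv → sym (∧-conicalʳ (distinct u v) _ uv)

mainTheorem3 : Σ SignedGraph λ S → Σ SignedGraph λ S' →
    Homogeneous S × IsParitySignedGraph S × IsSubsignedGraph S' S × Connected S' × ¬ IsParitySignedGraph S'
mainTheorem3 =
  sameParityGraph 3 , positiveComplete 2 ,
  sameParityGraph-homogeneous 3 ,
  sameParityGraph-parity 3 ,
  positiveEdge⇒positiveComplete₂-subsigned (sameParityGraph 3) {zero} {suc (suc zero)} refl refl ,
  positiveComplete-connected 1 ,
  positiveComplete-notParity 0
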